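{- Let $T$ be a theory of fields (in the language of $F$-algebras, with constants for a subfield $F$), and let $K_e(T)=K_{exp}(T)[\mathbb{L}^{ -1}]$ be the localized Grothendieck ring of exponential sums described in the context. Let $X$ be a definable set and $h:X\to k$ a definable function, and suppose $(u,x)\mapsto u+x$ is a definable action of the additive group $(k,+)$ on $X$ such that $h(u+x)=u+h(x)$ for all $u\in k$, $x\in X$. Then $[X,h]=0$ in $K_e(T)$.
   Context: $T$ is a theory of fields whose models are perfect fields; the field sort is denoted $k$; "definable" means quantifier-free definable in the language of $T$. $K_{exp}(T)$ is the commutative ring presented by generators $[X,h]$, where $X$ is a definable set and $h:X\to k$ a definable function, subject to the relations: (1) $[X,h][Y,g]=[X\times Y,(x,y)\mapsto h(x)+g(y)]$ and $[\text{point},0]=1$; (2) $[X,h]+[Y,g]=[X\cup Y,h\cup g]$ if $X,Y$ are disjoint; (3) $[Y,h]=[X,h\circ g]$ whenever $g:X\to Y$ is a definable bijection; (4) $[k,\mathrm{Id}]=0$. Put $\mathbb{L}=[k,0]$ and $K_e(T)=K_{exp}(T)[\mathbb{L}^{ -1}]$. -}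

module Defs where

open import Level using (Level) renaming (suc to lsuc; zero to lzero)
open import Data.Nat using (ℕ; zero; suc; _+_)
open import Data.Nat.Primality using (Prime)
open import Data.Fin using (Fin; zero; suc; _↑ˡ_; _↑ʳ_)
open import Data.Vec.Functional using (Vector; _++_; _∷_)
open import Data.Product using (Σ; _×_; _,_; ∃)
open import Data.Sum using (_⊎_)
open import Data.Unit using (⊤)
open import Data.Empty using (⊥)
open import Relation.Nullary using (¬_)
open import Relation.Binary.PropositionalEquality using (_≡_; _≢_)
open import Algebra.Structures using (IsCommutativeRing)

-- The language of F-algebras: ring language with a constant symbol for
-- each element of an index type C (the constants naming the subfield F).

data Term (C : Set) (n : ℕ) : Set where
  var  : Fin n → Term C n
  con  : C → Term C n
  zer  : Term C n
  one  : Term C n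
  _⊕_  : Term C n → Term C n → Term C n
  _⊗_  : Term C n → Term C n → Term C n
  neg  : Term C n → Term C n

data Formula (C : Set) : ℕ → Set where
  ⊤'   : ∀ {n} → Formula C n
  ⊥'   : ∀ {n} → Formula C n
  _≐_  : ∀ {n} → Term C n → Term C n → Formula C n
  ¬'_  : ∀ {n} → Formula C n → Formula C n
  _∧'_ : ∀ {n} → Formula C n → Formula C n → Formula C n
  _∨'_ : ∀ {n} → Formula C n → Formula C n → Formula C n
  ∀'   : ∀ {n} → Formula C (suc n) → Formula C n
  ∃'   : ∀ {n} → Formula C (suc n) → Formula C n

data QF {C : Set} : ∀ {n} → Formula C n → Set where
  qf⊤ : ∀ {n} → QF {n = n} ⊤'
  qf⊥ : ∀ {n} → QF {n = n} ⊥'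
  qf≐ : ∀ {n} (t s : Term C n) → QF (t ≐ s)
  qf¬ : ∀ {n} {φ : Formula C n} → QF φ → QF (¬' φ)
  qf∧ : ∀ {n} {φ ψ : Formula C n} → QF φ → QF ψ → QF (φ ∧' ψ)
  qf∨ : ∀ {n} {φ ψ : Formula C n} → QF φ → QF ψ → QF (φ ∨' ψ)

Sentence : Set → Set
Sentence C = Formula C 0

Theory : Set → Set₁
Theory C = Sentence C → Set

renT : ∀ {C n m} → (Fin n → Fin m) → Term C n → Term C m
renT r (var i) = var (r i)
renT r (con c) = con c
renT r zer = zer
renT r one = one
renT r (t ⊕ s) = renT r t ⊕ renT r s
renT r (t ⊗ s) = renT r t ⊗ renT r s
renT r (neg t) = neg (renT r t)

lift : ∀ {n m} → (Fin n → Fin m) → Fin (suc n) → Fin (suc m)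
lift r zero = zero
lift r (suc i) = suc (r i)

ren : ∀ {C n m} → (Fin n → Fin m) → Formula C n → Formula C m
ren r ⊤' = ⊤'
ren r ⊥' = ⊥'
ren r (t ≐ s) = renT r t ≐ renT r s
ren r (¬' φ) = ¬' ren r φ
ren r (φ ∧' ψ) = ren r φ ∧' ren r ψ
ren r (φ ∨' ψ) = ren r φ ∨' ren r ψ
ren r (∀' φ) = ∀' (ren (lift r) φ)
ren r (∃' φ) = ∃' (ren (lift r) φ)

ren-QF : ∀ {C n m} (r : Fin n → Fin m) {φ : Formula C n} → QF φ → QF (ren r φ)
ren-QF r qf⊤ = qf⊤
ren-QF r qf⊥ = qf⊥
ren-QF r (qf≐ t s) = qf≐ (renT r t) (renT r s)
ren-QF r (qf¬ p) = qf¬ (ren-QF r p)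
ren-QF r (qf∧ p q) = qf∧ (ren-QF r p) (ren-QF r q)
ren-QF r (qf∨ p q) = qf∨ (ren-QF r p) (ren-QF r q)

record Structure (C : Set) : Set₁ where
  field
    Carrier : Set
    _+ₘ_    : Carrier → Carrier → Carrier
    _*ₘ_    : Carrier → Carrier → Carrier
    -ₘ_     : Carrier → Carrier
    0ₘ      : Carrier
    1ₘ      : Carrier
    const   : C → Carrier

open Structure public

module _ {C : Set} (M : Structure C) where
  private
    Car = Carrier M
    _+ₘ'_ = _+ₘ_ M
    _*ₘ'_ = _*ₘ_ M
    -ₘ'_ = -ₘ_ M
    0ₘ' = 0ₘ M
    1ₘ' = 1ₘ M

  evalT : ∀ {n} → Term C n → Vector Car n → Car
  evalT (var i) ρ = ρ i
  evalT (con c) ρ = const M c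
  evalT zer ρ = 0ₘ'
  evalT one ρ = 1ₘ'
  evalT (t ⊕ s) ρ = evalT t ρ +ₘ' evalT s ρ
  evalT (t ⊗ s) ρ = evalT t ρ *ₘ' evalT s ρ
  evalT (neg t) ρ = -ₘ' evalT t ρ

  Sat : ∀ {n} → Formula C n → Vector Car n → Set
  Sat ⊤' ρ = ⊤
  Sat ⊥' ρ = ⊥
  Sat (t ≐ s) ρ = evalT t ρ ≡ evalT s ρ
  Sat (¬' φ) ρ = ¬ Sat φ ρ
  Sat (φ ∧' ψ) ρ = Sat φ ρ × Sat ψ ρ
  Sat (φ ∨' ψ) ρ = Sat φ ρ ⊎ Sat ψ ρ
  Sat (∀' φ) ρ = ∀ a → Sat φ (a ∷ ρ)
  Sat (∃' φ) ρ = Σ Car λ a → Sat φ (a ∷ ρ)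

  _·1 : ℕ → Car
  zero ·1 = 0ₘ'
  suc n ·1 = 1ₘ' +ₘ' (n ·1)

  _^ₘ_ : Car → ℕ → Car
  x ^ₘ zero = 1ₘ'
  x ^ₘ suc n = x *ₘ' (x ^ₘ n)

  IsField : Set
  IsField = IsCommutativeRing _≡_ _+ₘ'_ _*ₘ'_ -ₘ'_ 0ₘ' 1ₘ'
          × (0ₘ' ≢ 1ₘ')
          × (∀ x → x ≢ 0ₘ' → Σ Car λ y → x *ₘ' y ≡ 1ₘ')

  IsPerfectField : Set
  IsPerfectField = IsField
          × (∀ p → Prime p → (p ·1) ≡ 0ₘ' → ∀ y → Σ Car λ x → (x ^ₘ p) ≡ y)

Model : ∀ {C} → Theory C → Structure C → Set
Model T M = ∀ σ → T σ → Sat M σ (λ ())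

Holds : ∀ {C} → Theory C → (Structure C → Set) → Set₁
Holds T P = ∀ M → Model T M → P M

_≗ᵥ_ : ∀ {A : Set} {n} → Vector A n → Vector A n → Set
ρ ≗ᵥ σ = ∀ i → ρ i ≡ σ i

record DefSet (C : Set) (n : ℕ) : Set where
  constructor defset
  field
    fml  : Formula C n
    isQF : QF fml
open DefSet public

_∋_ : ∀ {C n} → DefSet C n → (M : Structure C) → Vector (Carrier M) n → Set
(X ∋ M) ρ = Sat M (fml X) ρ

kˢ : ∀ {C} n → DefSet C n
kˢ n = defset ⊤' qf⊤

_×ᵈ_ : ∀ {C n m} → DefSet C n → DefSet C m → DefSet C (n + m)
_×ᵈ_ {n = n} {m = m} X Y =
  defset (ren (_↑ˡ m) (fml X) ∧' ren (n ↑ʳ_) (fml Y))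
         (qf∧ (ren-QF (_↑ˡ m) (isQF X)) (ren-QF (n ↑ʳ_) (isQF Y)))

_∪ᵈ_ : ∀ {C n} → DefSet C n → DefSet C n → DefSet C n
X ∪ᵈ Y = defset (fml X ∨' fml Y) (qf∨ (isQF X) (isQF Y))

IsMapIn : ∀ {C n m} (M : Structure C) → DefSet C n → DefSet C m → Formula C (n + m) → Set
IsMapIn M X Y G =
    (∀ ρ → (X ∋ M) ρ →
       Σ (Vector (Carrier M) _) λ σ → (Y ∋ M) σ × Sat M G (ρ ++ σ)
         × (∀ σ' → Sat M G (ρ ++ σ') → σ ≗ᵥ σ'))
  × (∀ ρ σ → Sat M G (ρ ++ σ) → (X ∋ M) ρ)

record DefMap {C : Set} (T : Theory C) {n m : ℕ} (X : DefSet C n) (Y : DefSet C m) : Set₁ where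
  constructor defmap
  field
    graph  : Formula C (n + m)
    isQFg  : QF graph
    isMap  : Holds T λ M → IsMapIn M X Y graph
open DefMap public

_⟨_⟩_↦_ : ∀ {C} {T : Theory C} {n m} {X : DefSet C n} {Y : DefSet C m}
          → DefMap T X Y → (M : Structure C) → Vector (Carrier M) n → Vector (Carrier M) m → Set
f ⟨ M ⟩ ρ ↦ σ = Sat M (graph f) (ρ ++ σ)

DefFun : ∀ {C} (T : Theory C) {n} → DefSet C n → Set₁
DefFun T X = DefMap T X (kˢ 1)

zeroFun : ∀ {C} (T : Theory C) → DefFun T (kˢ 1)
zeroFun T = defmap (var (suc zero) ≐ zer) (qf≐ _ _)
  (λ M _ → (λ ρ _ → (λ _ → 0ₘ M) , _ , Relation.Binary.PropositionalEquality.refl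
                    , λ { σ' e zero → Relation.Binary.PropositionalEquality.sym e })
         , (λ ρ σ _ → _))
  where import Relation.Binary.PropositionalEquality

-- K_e(T) = K_exp(T)[𝕃⁻¹], presented by generators and relations:
-- commutative-ring expressions in the generators [X,h] and an extra
-- generator 𝕃⁻¹, modulo the least congruence containing the commutative
-- ring axioms, the relations (1)-(4), and 𝕃⁻¹ · 𝕃 = 1.

data KE {C : Set} (T : Theory C) : Set₁ where
  [_,_] : ∀ {n} (X : DefSet C n) → DefFun T X → KE T
  𝕃⁻¹   : KE T
  0ᴷ 1ᴷ : KE T
  _+ᴷ_  : KE T → KE T → KE T
  _*ᴷ_  : KE T → KE T → KE T
  -ᴷ_   : KE T → KE T

infixl 6 _+ᴷ_
infixl 7 _*ᴷ_

𝕃 : ∀ {C} {T : Theory C} → KE T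
𝕃 {T = T} = [ kˢ 1 , zeroFun T ]

data _≈ᴷ_ {C : Set} {T : Theory C} : KE T → KE T → Set₁ where
  ≈refl  : ∀ {a} → a ≈ᴷ a
  ≈sym   : ∀ {a b} → a ≈ᴷ b → b ≈ᴷ a
  ≈trans : ∀ {a b c} → a ≈ᴷ b → b ≈ᴷ c → a ≈ᴷ c
  +cong  : ∀ {a a' b b'} → a ≈ᴷ a' → b ≈ᴷ b' → (a +ᴷ b) ≈ᴷ (a' +ᴷ b')
  *cong  : ∀ {a a' b b'} → a ≈ᴷ a' → b ≈ᴷ b' → (a *ᴷ b) ≈ᴷ (a' *ᴷ b')
  -cong  : ∀ {a a'} → a ≈ᴷ a' → (-ᴷ a) ≈ᴷ (-ᴷ a')
  +assoc : ∀ a b c → ((a +ᴷ b) +ᴷ c) ≈ᴷ (a +ᴷ (b +ᴷ c))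
  +comm  : ∀ a b → (a +ᴷ b) ≈ᴷ (b +ᴷ a)
  +idʳ   : ∀ a → (a +ᴷ 0ᴷ) ≈ᴷ a
  +invʳ  : ∀ a → (a +ᴷ (-ᴷ a)) ≈ᴷ 0ᴷ
  *assoc : ∀ a b c → ((a *ᴷ b) *ᴷ c) ≈ᴷ (a *ᴷ (b *ᴷ c))
  *comm  : ∀ a b → (a *ᴷ b) ≈ᴷ (b *ᴷ a)
  *idʳ   : ∀ a → (a *ᴷ 1ᴷ) ≈ᴷ a
  distribʳ : ∀ a b c → ((a +ᴷ b) *ᴷ c) ≈ᴷ ((a *ᴷ c) +ᴷ (b *ᴷ c))
  rel-prod : ∀ {n m} (X : DefSet C n) (Y : DefSet C m)
             (h : DefFun T X) (g : DefFun T Y) (f : DefFun T (X ×ᵈ Y))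
           → Holds T (λ M → ∀ ρ σ a b c → h ⟨ M ⟩ ρ ↦ a → g ⟨ M ⟩ σ ↦ b
                          → f ⟨ M ⟩ (ρ ++ σ) ↦ c → c zero ≡ _+ₘ_ M (a zero) (b zero))
           → ([ X , h ] *ᴷ [ Y , g ]) ≈ᴷ [ X ×ᵈ Y , f ]
  rel-pt   : (f : DefFun T (kˢ 0))
           → Holds T (λ M → ∀ ρ c → f ⟨ M ⟩ ρ ↦ c → c zero ≡ 0ₘ M)
           → [ kˢ 0 , f ] ≈ᴷ 1ᴷ
  rel-union : ∀ {n} (X Y : DefSet C n) (h : DefFun T X) (g : DefFun T Y) (f : DefFun T (X ∪ᵈ Y))
           → Holds T (λ M → ∀ ρ → (X ∋ M) ρ → (Y ∋ M) ρ → ⊥)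
           → Holds T (λ M → ∀ ρ a c → h ⟨ M ⟩ ρ ↦ a → f ⟨ M ⟩ ρ ↦ c → c zero ≡ a zero)
           → Holds T (λ M → ∀ ρ b c → g ⟨ M ⟩ ρ ↦ b → f ⟨ M ⟩ ρ ↦ c → c zero ≡ b zero)
           → ([ X , h ] +ᴷ [ Y , g ]) ≈ᴷ [ X ∪ᵈ Y , f ]
  rel-bij : ∀ {n m} (X : DefSet C n) (Y : DefSet C m) (g : DefMap T X Y)
              (h : DefFun T Y) (f : DefFun T X)
           → Holds T (λ M → ∀ ρ ρ' σ → g ⟨ M ⟩ ρ ↦ σ → g ⟨ M ⟩ ρ' ↦ σ → ρ ≗ᵥ ρ')
           → Holds T (λ M → ∀ σ → (Y ∋ M) σ → Σ (Vector (Carrier M) n) λ ρ → g ⟨ M ⟩ ρ ↦ σ)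
           → Holds T (λ M → ∀ ρ σ a c → g ⟨ M ⟩ ρ ↦ σ → h ⟨ M ⟩ σ ↦ a → f ⟨ M ⟩ ρ ↦ c
                          → c zero ≡ a zero)
           → [ Y , h ] ≈ᴷ [ X , f ]
  rel-id  : (f : DefFun T (kˢ 1))
           → Holds T (λ M → ∀ ρ c → f ⟨ M ⟩ ρ ↦ c → c zero ≡ ρ zero)
           → [ kˢ 1 , f ] ≈ᴷ 0ᴷ
  rel-inv : (𝕃⁻¹ *ᴷ 𝕃) ≈ᴷ 1ᴷ

IsAddAction : ∀ {C} (T : Theory C) {n} (X : DefSet C n) → DefMap T (kˢ 1 ×ᵈ X) X → Set₁
IsAddAction T X act = Holds T λ M →
    (∀ ρ σ → (X ∋ M) ρ → act ⟨ M ⟩ ((λ _ → 0ₘ M) ++ ρ) ↦ σ → σ ≗ᵥ ρ)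
  × (∀ u v ρ σ τ τ' → (X ∋ M) ρ
       → act ⟨ M ⟩ (v ++ ρ) ↦ σ → act ⟨ M ⟩ (u ++ σ) ↦ τ
       → act ⟨ M ⟩ ((λ _ → _+ₘ_ M (u zero) (v zero)) ++ ρ) ↦ τ'
       → τ ≗ᵥ τ')

IsEquivariant : ∀ {C} (T : Theory C) {n} (X : DefSet C n) → DefFun T X → DefMap T (kˢ 1 ×ᵈ X) X → Set₁
IsEquivariant T X h act = Holds T λ M →
  ∀ u ρ σ a b → act ⟨ M ⟩ (u ++ ρ) ↦ σ → h ⟨ M ⟩ ρ ↦ a → h ⟨ M ⟩ σ ↦ b
    → b zero ≡ _+ₘ_ M (u zero) (a zero)

-- The action identifies X with k × h⁻¹(0) through (u , y) ↦ u + y, whose inverse is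
-- x ↦ (h x , (− h x) + x); equivariance turns h into the first projection under this
-- bijection. Hence [X , h] = [k × h⁻¹(0) , pr₁] = [k , Id] · [h⁻¹(0) , 0] = 0 · [h⁻¹(0) , 0] = 0.

module Submission where

open import Defs
open import Level using () renaming (suc to lsuc; zero to lzero)
open import Data.Nat as ℕ using (zero; suc)
open import Data.Fin using (Fin; zero; suc; _↑ˡ_; _↑ʳ_; splitAt)
open import Data.Vec.Functional using (Vector; _++_; map; tail)
open import Data.Vec.Functional.Properties using (lookup-++ˡ; lookup-++ʳ; ++-cong)
open import Data.Product using (Σ; _×_; _,_; proj₁; proj₂)
open import Data.Product.Function.NonDependent.Propositional using (_×-⇔_)
open import Data.Sum using (inj₁; inj₂)
open import Data.Sum.Function.Propositional using (_⊎-⇔_)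
open import Data.Unit using (tt)
open import Function using (_∘_; id)
open import Function.Bundles using (_⇔_; mk⇔; Equivalence)
import Function.Properties.Equivalence as ⇔
open import Function.Related.TypeIsomorphisms using (¬-cong-⇔)
open import Relation.Binary.Bundles using (Setoid)
open import Relation.Binary.PropositionalEquality
  using (_≡_; _≗_; refl; sym; trans; cong; cong₂; subst)
import Relation.Binary.Reasoning.Setoid as SetoidReasoning
open import Algebra.Structures using (IsGroup; IsCommutativeRing)
import Algebra.Consequences.Setoid as Consequences

open Equivalence using (to; from)

≡-cong-⇔ : ∀ {A : Set} {a a' b b' : A} → a ≡ a' → b ≡ b' → (a ≡ b) ⇔ (a' ≡ b')
≡-cong-⇔ refl refl = mk⇔ id id

map-++ : ∀ {A B : Set} {m k} (f : A → B) (xs : Vector A m) (ys : Vector A k)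
       → map f (xs ++ ys) ≗ map f xs ++ map f ys
map-++ {m = m} f xs ys i with splitAt m i
... | inj₁ _ = refl
... | inj₂ _ = refl

≗-singleton : ∀ {A : Set} {a b : Vector A 1} → a zero ≡ b zero → a ≗ b
≗-singleton a₀≡b₀ zero = a₀≡b₀

≗-head-tail : ∀ {A : Set} {m} {ρ ρ' : Vector A (suc m)}
            → ρ zero ≡ ρ' zero → tail ρ ≗ tail ρ' → ρ ≗ ρ'
≗-head-tail head≡ tail≗ zero = head≡
≗-head-tail head≡ tail≗ (suc i) = tail≗ i

head++tail : ∀ {A : Set} {m} (ρ : Vector A (suc m)) → ρ ≗ (λ _ → ρ zero) ++ tail ρ
head++tail ρ = ≗-head-tail refl (λ _ → refl)

exts : ∀ {C n m} → (Fin n → Term C m) → Fin (suc n) → Term C (suc m)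
exts s zero = var zero
exts s (suc i) = renT suc (s i)

subT : ∀ {C n m} → (Fin n → Term C m) → Term C n → Term C m
subT s (var i) = s i
subT s (con c) = con c
subT s zer = zer
subT s one = one
subT s (t ⊕ u) = subT s t ⊕ subT s u
subT s (t ⊗ u) = subT s t ⊗ subT s u
subT s (neg t) = neg (subT s t)

subF : ∀ {C n m} → (Fin n → Term C m) → Formula C n → Formula C m
subF s ⊤' = ⊤'
subF s ⊥' = ⊥'
subF s (t ≐ u) = subT s t ≐ subT s u
subF s (¬' φ) = ¬' subF s φ
subF s (φ ∧' ψ) = subF s φ ∧' subF s ψ
subF s (φ ∨' ψ) = subF s φ ∨' subF s ψ
subF s (∀' φ) = ∀' (subF (exts s) φ)
subF s (∃' φ) = ∃' (subF (exts s) φ)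

subF-QF : ∀ {C n m} (s : Fin n → Term C m) {φ : Formula C n} → QF φ → QF (subF s φ)
subF-QF s qf⊤ = qf⊤
subF-QF s qf⊥ = qf⊥
subF-QF s (qf≐ t u) = qf≐ (subT s t) (subT s u)
subF-QF s (qf¬ p) = qf¬ (subF-QF s p)
subF-QF s (qf∧ p q) = qf∧ (subF-QF s p) (subF-QF s q)
subF-QF s (qf∨ p q) = qf∨ (subF-QF s p) (subF-QF s q)

renT≡subT : ∀ {C n m} (r : Fin n → Fin m) (t : Term C n) → renT r t ≡ subT (var ∘ r) t
renT≡subT r (var i) = refl
renT≡subT r (con c) = refl
renT≡subT r zer = refl
renT≡subT r one = refl
renT≡subT r (t ⊕ u) = cong₂ _⊕_ (renT≡subT r t) (renT≡subT r u)
renT≡subT r (t ⊗ u) = cong₂ _⊗_ (renT≡subT r t) (renT≡subT r u)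
renT≡subT r (neg t) = cong neg (renT≡subT r t)

ren≡subF : ∀ {C n m} (r : Fin n → Fin m) {φ : Formula C n} → QF φ → ren r φ ≡ subF (var ∘ r) φ
ren≡subF r qf⊤ = refl
ren≡subF r qf⊥ = refl
ren≡subF r (qf≐ t u) = cong₂ _≐_ (renT≡subT r t) (renT≡subT r u)
ren≡subF r (qf¬ p) = cong ¬'_ (ren≡subF r p)
ren≡subF r (qf∧ p q) = cong₂ _∧'_ (ren≡subF r p) (ren≡subF r q)
ren≡subF r (qf∨ p q) = cong₂ _∨'_ (ren≡subF r p) (ren≡subF r q)

module _ {C : Set} (M : Structure C) where

  evalT-cong : ∀ {n} (t : Term C n) {ρ ρ' : Vector (Carrier M) n}
             → ρ ≗ ρ' → evalT M t ρ ≡ evalT M t ρ'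
  evalT-cong (var i) ρ≗ρ' = ρ≗ρ' i
  evalT-cong (con c) ρ≗ρ' = refl
  evalT-cong zer ρ≗ρ' = refl
  evalT-cong one ρ≗ρ' = refl
  evalT-cong (t ⊕ u) ρ≗ρ' = cong₂ (_+ₘ_ M) (evalT-cong t ρ≗ρ') (evalT-cong u ρ≗ρ')
  evalT-cong (t ⊗ u) ρ≗ρ' = cong₂ (_*ₘ_ M) (evalT-cong t ρ≗ρ') (evalT-cong u ρ≗ρ')
  evalT-cong (neg t) ρ≗ρ' = cong (-ₘ_ M) (evalT-cong t ρ≗ρ')

  sat-cong : ∀ {n} {φ : Formula C n} → QF φ → {ρ ρ' : Vector (Carrier M) n}
           → ρ ≗ ρ' → Sat M φ ρ ⇔ Sat M φ ρ'
  sat-cong qf⊤ ρ≗ρ' = ⇔.refl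
  sat-cong qf⊥ ρ≗ρ' = ⇔.refl
  sat-cong (qf≐ t u) ρ≗ρ' = ≡-cong-⇔ (evalT-cong t ρ≗ρ') (evalT-cong u ρ≗ρ')
  sat-cong (qf¬ p) ρ≗ρ' = ¬-cong-⇔ (sat-cong p ρ≗ρ')
  sat-cong (qf∧ p q) ρ≗ρ' = sat-cong p ρ≗ρ' ×-⇔ sat-cong q ρ≗ρ'
  sat-cong (qf∨ p q) ρ≗ρ' = sat-cong p ρ≗ρ' ⊎-⇔ sat-cong q ρ≗ρ'

  evalT-sub : ∀ {n m} (s : Fin n → Term C m) (t : Term C n) (ρ : Vector (Carrier M) m)
            → evalT M (subT s t) ρ ≡ evalT M t (λ i → evalT M (s i) ρ)
  evalT-sub s (var i) ρ = refl
  evalT-sub s (con c) ρ = refl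
  evalT-sub s zer ρ = refl
  evalT-sub s one ρ = refl
  evalT-sub s (t ⊕ u) ρ = cong₂ (_+ₘ_ M) (evalT-sub s t ρ) (evalT-sub s u ρ)
  evalT-sub s (t ⊗ u) ρ = cong₂ (_*ₘ_ M) (evalT-sub s t ρ) (evalT-sub s u ρ)
  evalT-sub s (neg t) ρ = cong (-ₘ_ M) (evalT-sub s t ρ)

  sat-sub : ∀ {n m} (s : Fin n → Term C m) {φ : Formula C n} → QF φ → (ρ : Vector (Carrier M) m)
          → Sat M (subF s φ) ρ ⇔ Sat M φ (λ i → evalT M (s i) ρ)
  sat-sub s qf⊤ ρ = ⇔.refl
  sat-sub s qf⊥ ρ = ⇔.refl
  sat-sub s (qf≐ t u) ρ = ≡-cong-⇔ (evalT-sub s t ρ) (evalT-sub s u ρ)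
  sat-sub s (qf¬ p) ρ = ¬-cong-⇔ (sat-sub s p ρ)
  sat-sub s (qf∧ p q) ρ = sat-sub s p ρ ×-⇔ sat-sub s q ρ
  sat-sub s (qf∨ p q) ρ = sat-sub s p ρ ⊎-⇔ sat-sub s q ρ

  sat-ren : ∀ {n m} (r : Fin n → Fin m) {φ : Formula C n} → QF φ → (ρ : Vector (Carrier M) m)
          → Sat M (ren r φ) ρ ⇔ Sat M φ (ρ ∘ r)
  sat-ren r {φ} p ρ = subst (λ ψ → Sat M ψ ρ ⇔ Sat M φ (ρ ∘ r)) (sym (ren≡subF r p)) (sat-sub (var ∘ r) p ρ)

  evalT-weaken : ∀ {n k} (t : Term C n) (ρ : Vector (Carrier M) n) (σ : Vector (Carrier M) k)
               → evalT M (renT (_↑ˡ k) t) (ρ ++ σ) ≡ evalT M t ρ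
  evalT-weaken {k = k} t ρ σ = begin
    evalT M (renT (_↑ˡ k) t) (ρ ++ σ)          ≡⟨ cong (λ u → evalT M u (ρ ++ σ)) (renT≡subT (_↑ˡ k) t) ⟩
    evalT M (subT (var ∘ (_↑ˡ k)) t) (ρ ++ σ)  ≡⟨ evalT-sub (var ∘ (_↑ˡ k)) t (ρ ++ σ) ⟩
    evalT M t ((ρ ++ σ) ∘ (_↑ˡ k))             ≡⟨ evalT-cong t (lookup-++ˡ ρ σ) ⟩
    evalT M t ρ                                ∎
    where open Relation.Binary.PropositionalEquality.≡-Reasoning

  sat-weaken : ∀ {n k} {φ : Formula C n} → QF φ → (ρ : Vector (Carrier M) n) (σ : Vector (Carrier M) k)
             → Sat M (ren (_↑ˡ k) φ) (ρ ++ σ) ⇔ Sat M φ ρ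
  sat-weaken p ρ σ = ⇔.trans (sat-ren _ p (ρ ++ σ)) (sat-cong p (lookup-++ˡ ρ σ))

  ∈-×ᵈ : ∀ {n m} (X : DefSet C n) (Y : DefSet C m) {ρ : Vector (Carrier M) _}
       → ((X ×ᵈ Y) ∋ M) ρ ⇔ ((X ∋ M) (ρ ∘ (_↑ˡ m)) × (Y ∋ M) (ρ ∘ (n ↑ʳ_)))
  ∈-×ᵈ X Y {ρ} = sat-ren _ (isQF X) ρ ×-⇔ sat-ren _ (isQF Y) ρ

module _ {C : Set} (T : Theory C) where

  KE-setoid : Setoid (lsuc lzero) (lsuc lzero)
  KE-setoid = record
    { Carrier = KE T
    ; _≈_ = _≈ᴷ_
    ; isEquivalence = record { refl = ≈refl ; sym = ≈sym ; trans = ≈trans }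
    }

  KE-isCommutativeRing : IsCommutativeRing _≈ᴷ_ _+ᴷ_ _*ᴷ_ -ᴷ_ 0ᴷ 1ᴷ
  KE-isCommutativeRing = record
    { isRing = record
      { +-isAbelianGroup = record
        { isGroup = record
          { isMonoid = record
            { isSemigroup = record
              { isMagma = record { isEquivalence = Setoid.isEquivalence KE-setoid ; ∙-cong = +cong }
              ; assoc = +assoc
              }
            ; identity = comm∧idʳ⇒id +comm +idʳ
            }
          ; inverse = comm∧invʳ⇒inv +comm +invʳ
          ; ⁻¹-cong = -cong
          }
        ; comm = +comm
        }
      ; *-cong = *cong
      ; *-assoc = *assoc
      ; *-identity = comm∧idʳ⇒id *comm *idʳ
      ; distrib = comm∧distrʳ⇒distr +cong *comm (λ a b c → distribʳ b c a)
      }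
    ; *-comm = *comm
    }
    where open Consequences KE-setoid

module _ {C : Set} {T : Theory C} {n m} {X : DefSet C n} {Y : DefSet C m} (f : DefMap T X Y) where

  ↦-cong : ∀ {M : Structure C} {ρ ρ' σ σ'} → ρ ≗ ρ' → σ ≗ σ'
         → f ⟨ M ⟩ ρ ↦ σ → f ⟨ M ⟩ ρ' ↦ σ'
  ↦-cong {M} {ρ} {ρ'} ρ≗ρ' σ≗σ' = to (sat-cong M (isQFg f) (++-cong ρ ρ' ρ≗ρ' σ≗σ'))

  module _ {M : Structure C} (M⊨T : Model T M) where

    ↦-total : ∀ {ρ} → (X ∋ M) ρ → Σ (Vector (Carrier M) m) λ σ → (Y ∋ M) σ × f ⟨ M ⟩ ρ ↦ σ
    ↦-total ρ∈X = let σ , σ∈Y , ρ↦σ , _ = proj₁ (isMap f M M⊨T) _ ρ∈X in σ , σ∈Y , ρ↦σ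

    ↦-domain : ∀ {ρ σ} → f ⟨ M ⟩ ρ ↦ σ → (X ∋ M) ρ
    ↦-domain = proj₂ (isMap f M M⊨T) _ _

    ↦-functional : ∀ {ρ σ σ'} → f ⟨ M ⟩ ρ ↦ σ → f ⟨ M ⟩ ρ ↦ σ' → σ ≗ σ'
    ↦-functional ρ↦σ ρ↦σ' =
      let _ , _ , _ , unique = proj₁ (isMap f M M⊨T) _ (↦-domain ρ↦σ)
      in λ i → trans (sym (unique _ ρ↦σ i)) (unique _ ρ↦σ' i)

    ↦-codomain : ∀ {ρ σ} → f ⟨ M ⟩ ρ ↦ σ → (Y ∋ M) σ
    ↦-codomain ρ↦σ =
      let σ₀ , σ₀∈Y , ρ↦σ₀ = ↦-total (↦-domain ρ↦σ)
      in to (sat-cong M (isQF Y) (↦-functional ρ↦σ₀ ρ↦σ)) σ₀∈Y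

module _ {C : Set} where

  _⊢_⊆_ : ∀ {n} → Theory C → DefSet C n → DefSet C n → Set₁
  T ⊢ Y ⊆ X = Holds T λ M → ∀ ρ → (Y ∋ M) ρ → (X ∋ M) ρ

  termGraph : ∀ {n} → Term C n → Formula C (n ℕ.+ 1)
  termGraph {n} t = var (n ↑ʳ zero) ≐ renT (_↑ˡ 1) t

  sat-termGraph : ∀ {n} (M : Structure C) (t : Term C n) (ρ : Vector (Carrier M) n) (c : Vector (Carrier M) 1)
                → Sat M (termGraph t) (ρ ++ c) ⇔ (c zero ≡ evalT M t ρ)
  sat-termGraph M t ρ c = ≡-cong-⇔ (lookup-++ʳ ρ c zero) (evalT-weaken M t ρ c)

IsAdditiveGroup : ∀ {C} → Structure C → Set
IsAdditiveGroup M = IsGroup _≡_ (_+ₘ_ M) (0ₘ M) (-ₘ_ M)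

module _ {C : Set} {T : Theory C} where

  termFun : ∀ {n} → Term C n → DefFun T (kˢ n)
  termFun t = defmap (termGraph t) (qf≐ _ _) λ M _ →
      (λ ρ _ → (λ _ → evalT M t ρ) , tt , from (sat-termGraph M t ρ _) refl
             , λ c ρ↦c → ≗-singleton (sym (to (sat-termGraph M t ρ c) ρ↦c)))
    , (λ _ _ _ → tt)

  restrict : ∀ {n m} {X : DefSet C n} {Z : DefSet C m}
           → DefMap T X Z → (Y : DefSet C n) → T ⊢ Y ⊆ X → DefMap T Y Z
  restrict {m = m} f Y Y⊆X =
    defmap (graph f ∧' ren (_↑ˡ m) (fml Y)) (qf∧ (isQFg f) (ren-QF _ (isQF Y))) λ M M⊨T →
        (λ ρ ρ∈Y → let σ , σ∈Z , ρ↦σ = ↦-total f M⊨T (Y⊆X M M⊨T ρ ρ∈Y)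
                   in σ , σ∈Z , (ρ↦σ , from (sat-weaken M (isQF Y) ρ σ) ρ∈Y)
                    , λ σ' ρ↦σ' → ↦-functional f M⊨T ρ↦σ (proj₁ ρ↦σ'))
      , (λ ρ σ ρ↦σ → to (sat-weaken M (isQF Y) ρ σ) (proj₂ ρ↦σ))

  restrict-⇔ : ∀ {n m} {X : DefSet C n} {Z : DefSet C m} (f : DefMap T X Z) (Y : DefSet C n)
               (Y⊆X : T ⊢ Y ⊆ X) {M : Structure C} {ρ σ}
             → restrict f Y Y⊆X ⟨ M ⟩ ρ ↦ σ ⇔ (f ⟨ M ⟩ ρ ↦ σ × (Y ∋ M) ρ)
  restrict-⇔ f Y Y⊆X {M} {ρ} {σ} = ⇔.refl ×-⇔ sat-weaken M (isQF Y) ρ σ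

  zeros : ∀ {n} {X : DefSet C n} → DefFun T X → DefSet C n
  zeros h = defset (subF (var ++ λ _ → zer) (graph h)) (subF-QF _ (isQFg h))

  ∈-zeros : ∀ {n} {X : DefSet C n} (h : DefFun T X) {M : Structure C} {y}
          → (zeros h ∋ M) y ⇔ h ⟨ M ⟩ y ↦ (λ _ → 0ₘ M)
  ∈-zeros h {M} {y} = ⇔.trans (sat-sub M _ (isQFg h) y)
                              (sat-cong M (isQFg h) (map-++ (λ t → evalT M t y) var (λ _ → zer)))

  zeros⊆ : ∀ {n} {X : DefSet C n} (h : DefFun T X) → T ⊢ zeros h ⊆ X
  zeros⊆ h M M⊨T y y∈zeros = ↦-domain h M⊨T (to (∈-zeros h) y∈zeros)

  idFun : DefFun T (kˢ 1)
  idFun = termFun (var zero)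

  zeroOn : ∀ {n} (Y : DefSet C n) → DefFun T Y
  zeroOn Y = restrict (termFun zer) Y λ _ _ _ _ → tt

  fstOn : ∀ {n} (Y : DefSet C n) → DefFun T (kˢ 1 ×ᵈ Y)
  fstOn Y = restrict (termFun (var zero)) (kˢ 1 ×ᵈ Y) λ _ _ _ _ → tt

  fstOn-value : ∀ {n} (Y : DefSet C n) {M : Structure C} {ρ c}
              → fstOn Y ⟨ M ⟩ ρ ↦ c → c zero ≡ ρ zero
  fstOn-value Y {M} {ρ} {c} ρ↦c = to (sat-termGraph M (var zero) ρ c) (proj₁ ρ↦c)

  identity-vanishes : [ kˢ 1 , idFun ] ≈ᴷ 0ᴷ
  identity-vanishes = rel-id idFun λ M _ ρ c → to (sat-termGraph M (var zero) ρ c)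

  projection-factorises : Holds T IsAdditiveGroup → ∀ {n} (Y : DefSet C n)
                        → ([ kˢ 1 , idFun ] *ᴷ [ Y , zeroOn Y ]) ≈ᴷ [ kˢ 1 ×ᵈ Y , fstOn Y ]
  projection-factorises groups Y = rel-prod (kˢ 1) Y idFun (zeroOn Y) (fstOn Y)
    λ M M⊨T ρ σ a b c ρ↦a σ↦b ρσ↦c → begin
      c zero                  ≡⟨ fstOn-value Y ρσ↦c ⟩
      ρ zero                  ≡⟨ IsGroup.identityʳ (groups M M⊨T) (ρ zero) ⟨
      _+ₘ_ M (ρ zero) (0ₘ M)  ≡⟨ cong₂ (_+ₘ_ M) (sym (to (sat-termGraph M (var zero) ρ a) ρ↦a))
                                                (sym (to (sat-termGraph M zer σ b) (proj₁ σ↦b))) ⟩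
      _+ₘ_ M (a zero) (b zero) ∎
    where open Relation.Binary.PropositionalEquality.≡-Reasoning

  projection-vanishes : Holds T IsAdditiveGroup → ∀ {n} (Y : DefSet C n)
                      → [ kˢ 1 ×ᵈ Y , fstOn Y ] ≈ᴷ 0ᴷ
  projection-vanishes groups Y = begin
    [ kˢ 1 ×ᵈ Y , fstOn Y ]              ≈⟨ projection-factorises groups Y ⟨
    [ kˢ 1 , idFun ] *ᴷ [ Y , zeroOn Y ] ≈⟨ *cong identity-vanishes ≈refl ⟩
    0ᴷ *ᴷ [ Y , zeroOn Y ]               ≈⟨ IsCommutativeRing.zeroˡ (KE-isCommutativeRing T) _ ⟩
    0ᴷ                                   ∎
    where open SetoidReasoning (KE-setoid T)

module AdditiveTrivialisation {C : Set} {T : Theory C} (groups : Holds T IsAdditiveGroup)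
    {n} {X : DefSet C n} (h : DefFun T X) (act : DefMap T (kˢ 1 ×ᵈ X) X)
    (isAct : IsAddAction T X act) (isEq : IsEquivariant T X h act) where

  base : DefSet C (suc n)
  base = kˢ 1 ×ᵈ zeros h

  base⊆k×X : T ⊢ base ⊆ (kˢ 1 ×ᵈ X)
  base⊆k×X M M⊨T ρ ρ∈base =
    from (∈-×ᵈ M (kˢ 1) X) (tt , zeros⊆ h M M⊨T _ (proj₂ (to (∈-×ᵈ M (kˢ 1) (zeros h)) ρ∈base)))

  addition : DefMap T base X
  addition = restrict act base base⊆k×X

  projection : DefFun T base
  projection = fstOn (zeros h)

  module _ {M : Structure C} (M⊨T : Model T M) where
    open Structure M using () renaming (Carrier to A; _+ₘ_ to _+_; -ₘ_ to -_; 0ₘ to 0#)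
    open IsGroup (groups M M⊨T) using (identityʳ; inverseˡ; inverseʳ)

    _·_↦_ : A → Vector A n → Vector A n → Set
    u · x ↦ σ = act ⟨ M ⟩ ((λ _ → u) ++ x) ↦ σ

    𝟎 : Vector A 1
    𝟎 _ = 0#

    act-total : ∀ {u x} → (X ∋ M) x → Σ (Vector A n) λ σ → (X ∋ M) σ × u · x ↦ σ
    act-total x∈X = ↦-total act M⊨T (from (∈-×ᵈ M (kˢ 1) X) (tt , x∈X))

    act-inverse : ∀ {u v x σ τ} → (X ∋ M) x → v · x ↦ σ → u · σ ↦ τ → u + v ≡ 0# → τ ≗ x
    act-inverse {u} {v} x∈X vx↦σ uσ↦τ u+v≡0 =
      let τ' , _ , [u+v]x↦τ' = act-total {u + v} x∈X
          compose , identity = proj₂ (isAct M M⊨T) , proj₁ (isAct M M⊨T)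
      in λ i → trans (compose (λ _ → u) (λ _ → v) _ _ _ _ x∈X vx↦σ uσ↦τ [u+v]x↦τ' i)
                     (identity _ _ x∈X (subst (λ w → w · _ ↦ τ') u+v≡0 [u+v]x↦τ') i)

    h-equivariant : ∀ {u x σ a b} → u · x ↦ σ → h ⟨ M ⟩ x ↦ a → h ⟨ M ⟩ σ ↦ b → b zero ≡ u + a zero
    h-equivariant = isEq M M⊨T _ _ _ _ _

    addition-elim : ∀ {ρ σ} → addition ⟨ M ⟩ ρ ↦ σ → (ρ zero · tail ρ ↦ σ) × h ⟨ M ⟩ tail ρ ↦ 𝟎
    addition-elim {ρ} ρ↦σ =
      let act↦ , ρ∈base = to (restrict-⇔ act base base⊆k×X) ρ↦σ
      in ↦-cong act (head++tail ρ) (λ _ → refl) act↦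
       , to (∈-zeros h) (proj₂ (to (∈-×ᵈ M (kˢ 1) (zeros h)) ρ∈base))

    addition-intro : ∀ {u y σ} → u · y ↦ σ → h ⟨ M ⟩ y ↦ 𝟎 → addition ⟨ M ⟩ ((λ _ → u) ++ y) ↦ σ
    addition-intro uy↦σ y↦0 =
      from (restrict-⇔ act base base⊆k×X) (uy↦σ , from (∈-×ᵈ M (kˢ 1) (zeros h)) (tt , from (∈-zeros h) y↦0))

    preimage-coordinates : ∀ {u y σ b z} → u · y ↦ σ → h ⟨ M ⟩ y ↦ 𝟎
                         → h ⟨ M ⟩ σ ↦ b → (- b zero) · σ ↦ z → u ≡ b zero × y ≗ z
    preimage-coordinates {u} {b = b} uy↦σ y↦0 σ↦b σ↦z =
      u≡b₀ , λ i → sym (act-inverse (↦-domain h M⊨T y↦0) uy↦σ σ↦z -b₀+u≡0 i)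
      where
        u≡b₀ : u ≡ b zero
        u≡b₀ = sym (trans (h-equivariant uy↦σ y↦0 σ↦b) (identityʳ u))
        -b₀+u≡0 : (- b zero) + u ≡ 0#
        -b₀+u≡0 = subst (λ w → (- b zero) + w ≡ 0#) (sym u≡b₀) (inverseˡ (b zero))

    addition-injective : ∀ ρ ρ' σ → addition ⟨ M ⟩ ρ ↦ σ → addition ⟨ M ⟩ ρ' ↦ σ → ρ ≗ ρ'
    addition-injective ρ ρ' σ ρ↦σ ρ'↦σ =
      let uy↦σ , y↦0 = addition-elim ρ↦σ
          u'y'↦σ , y'↦0 = addition-elim ρ'↦σ
          σ∈X = ↦-codomain act M⊨T uy↦σ
          b , _ , σ↦b = ↦-total h M⊨T σ∈X
          z , _ , σ↦z = act-total σ∈X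
          u≡b₀ , y≗z = preimage-coordinates uy↦σ y↦0 σ↦b σ↦z
          u'≡b₀ , y'≗z = preimage-coordinates u'y'↦σ y'↦0 σ↦b σ↦z
      in ≗-head-tail (trans u≡b₀ (sym u'≡b₀)) (λ i → trans (y≗z i) (sym (y'≗z i)))

    addition-surjective : ∀ σ → (X ∋ M) σ → Σ (Vector A (suc n)) λ ρ → addition ⟨ M ⟩ ρ ↦ σ
    addition-surjective σ σ∈X =
      let b , _ , σ↦b = ↦-total h M⊨T σ∈X
          a = b zero
          y , y∈X , [-a]σ↦y = act-total {u = - a} σ∈X
          c , _ , y↦c = ↦-total h M⊨T y∈X
          σ' , _ , ay↦σ' = act-total {a} y∈X
          c₀≡0 = trans (h-equivariant [-a]σ↦y σ↦b y↦c) (inverseˡ a)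
          σ'≗σ = act-inverse σ∈X [-a]σ↦y ay↦σ' (inverseʳ a)
      in (λ _ → a) ++ y
       , addition-intro (↦-cong act (λ _ → refl) σ'≗σ ay↦σ')
                        (↦-cong h (λ _ → refl) (≗-singleton c₀≡0) y↦c)

    h∘addition≡fst : ∀ ρ σ a c → addition ⟨ M ⟩ ρ ↦ σ → h ⟨ M ⟩ σ ↦ a
                   → projection ⟨ M ⟩ ρ ↦ c → c zero ≡ a zero
    h∘addition≡fst ρ σ a c ρ↦σ σ↦a ρ↦c =
      let uy↦σ , y↦0 = addition-elim ρ↦σ
      in trans (fstOn-value {T = T} (zeros h) ρ↦c)
               (sym (trans (h-equivariant uy↦σ y↦0 σ↦a) (identityʳ (ρ zero))))

  h≈projection : [ X , h ] ≈ᴷ [ base , projection ]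
  h≈projection = rel-bij base X addition h projection
    (λ M → addition-injective) (λ M → addition-surjective) (λ M → h∘addition≡fst)

lemma3p1 : ∀ {C : Set} (T : Theory C)
    → Holds T (λ M → IsPerfectField M)
    → ∀ {n} (X : DefSet C n) (h : DefFun T X) (act : DefMap T (kˢ 1 ×ᵈ X) X)
    → IsAddAction T X act
    → IsEquivariant T X h act
    → [ X , h ] ≈ᴷ 0ᴷ
lemma3p1 T perfect X h act isAct isEq =
  ≈trans (AdditiveTrivialisation.h≈projection groups h act isAct isEq)
         (projection-vanishes groups (zeros h))
  where
    groups : Holds T IsAdditiveGroup
    groups M M⊨T = IsCommutativeRing.+-isGroup (proj₁ (proj₁ (perfect M M⊨T)))
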